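{- Let $r$ be a positive integer. For every fixed integer $k \ge r$, $ex_k(m, P_{r,2}) = \Theta(m^r)$ as $m\to\infty$; that is, there are constants $0<a\le b$ depending on $r$ and $k$ such that $a m^r \le ex_k(m,P_{r,2}) \le b m^r$ for all sufficiently large $m$.
   Context: $P_{r,c}$ denotes the $r\times c$ matrix all of whose entries are one. A $0-1$ matrix $A$ contains a $0-1$ matrix $M$ if some submatrix of $A$ can be transformed into $M$ by changing some ones to zeroes; otherwise $A$ avoids $M$. $ex_k(m,P)$ is the maximum number of columns in a $0-1$ matrix with $m$ rows that avoids $P$ and has at least $k$ ones in every column. -}

module Defs where

open import Data.Nat as ℕ using (ℕ; _≥_)
open import Data.Bool using (Bool; true)
open import Data.Fin using (Fin; _<_)
open import Data.Fin.Subset using (∣_∣)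
open import Data.Vec using (tabulate)
open import Data.Product using (Σ; _×_)
open import Relation.Binary.PropositionalEquality using (_≡_)
open import Relation.Nullary using (¬_)

Matrix : ℕ → ℕ → Set
Matrix r c = Fin r → Fin c → Bool

P : (r c : ℕ) → Matrix r c
P r c _ _ = true

StrictlyIncreasing : ∀ {a b} → (Fin a → Fin b) → Set
StrictlyIncreasing f = ∀ i j → i < j → f i < f j

Contains : ∀ {m n r c} → Matrix m n → Matrix r c → Set
Contains {m} {n} {r} {c} A M =
  Σ (Fin r → Fin m) λ f → Σ (Fin c → Fin n) λ g →
    StrictlyIncreasing f × StrictlyIncreasing g ×
    (∀ i j → M i j ≡ true → A (f i) (g j) ≡ true)

Avoids : ∀ {m n r c} → Matrix m n → Matrix r c → Set
Avoids A M = ¬ Contains A M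

onesInColumn : ∀ {m n} → Matrix m n → Fin n → ℕ
onesInColumn A j = ∣ tabulate (λ i → A i j) ∣

Admissible : ∀ {m n r c} → ℕ → Matrix r c → Matrix m n → Set
Admissible {n = n} k M A = Avoids A M × (∀ (j : Fin n) → onesInColumn A j ≥ k)

IsEx : ∀ {r c} → ℕ → ℕ → Matrix r c → ℕ → Set
IsEx {r} {c} k m M e =
  Σ (Matrix m e) (Admissible k M) ×
  (∀ (n : ℕ) (A : Matrix m n) → Admissible k M A → n ℕ.≤ e)

module Submission where

open import Defs

-- Every column of an admissible matrix has at least k ≥ r ones,
-- hence an increasing r-tuple of rows holding ones; two columns with the same
-- tuple would form a copy of P_{r,2}, so by pigeonhole there are at most m ^ r
-- columns. Since A avoids P_{r,2} iff any two columns share fewer than r ones,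
-- admissibility is decidable, and ex_k(m, P_{r,2}) exists as the largest
-- realisable number of columns below m ^ r.
--
-- Split the rows into blocks of k and index
-- the columns by the polynomials with r coefficients below q = ⌊m / d⌋; the
-- column of f has a one at position p of block f(p). Distinct polynomials agree
-- on fewer than r points (synthetic division over ℤ), so this matrix avoids
-- P_{r,2} with k ones per column, and ex ≥ q ^ r ≥ m ^ r / (2d) ^ r.

module Polynomials where

  open import Data.Nat as ℕ using (ℕ; zero; suc)
  open import Data.Integer using (ℤ; +_; 0ℤ; _+_; _*_; _-_)
  import Data.Integer.Properties as ℤP
  open import Data.Integer.Tactic.RingSolver using (solve-∀)
  open import Data.Fin using (Fin; zero; suc)
  import Data.Fin.Properties as FP
  open import Data.Vec using (Vec; []; _∷_; zipWith)
  open import Data.Vec.Relation.Unary.All using (All; []; _∷_)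
  open import Data.Sum using ([_,_]′)
  open import Function using (_∘_; id)
  open import Function.Definitions using (Injective)
  open import Relation.Binary.PropositionalEquality
  open import Relation.Nullary using (contradiction)

  -- Polynomials are coefficient vectors, constant term first, evaluated by Horner's rule.
  evalℤ : ∀ {n} → Vec ℤ n → ℤ → ℤ
  evalℤ [] x = 0ℤ
  evalℤ (c ∷ p) x = c + x * evalℤ p x

  divideBy : ∀ {n} → Vec ℤ (suc n) → ℤ → Vec ℤ n
  divideBy (c ∷ []) a = []
  divideBy (c ∷ c' ∷ p) a = evalℤ (c' ∷ p) a ∷ divideBy (c' ∷ p) a

  c+a*0≡c : ∀ c a → c + a * 0ℤ ≡ c
  c+a*0≡c = solve-∀

  division : ∀ {n} (p : Vec ℤ (suc n)) a x →
    evalℤ p x ≡ (x - a) * evalℤ (divideBy p a) x + evalℤ p a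
  division (c ∷ []) a x = constant c x a
    where
    constant : ∀ c x a → c + x * 0ℤ ≡ (x - a) * 0ℤ + (c + a * 0ℤ)
    constant = solve-∀
  division (c ∷ c' ∷ p) a x = begin
    c + x * evalℤ (c' ∷ p) x
      ≡⟨ cong (λ v → c + x * v) (division (c' ∷ p) a x) ⟩
    c + x * ((x - a) * evalℤ (divideBy (c' ∷ p) a) x + evalℤ (c' ∷ p) a)
      ≡⟨ regroup c x a _ _ ⟩
    (x - a) * (evalℤ (c' ∷ p) a + x * evalℤ (divideBy (c' ∷ p) a) x) + (c + a * evalℤ (c' ∷ p) a) ∎
    where
    open ≡-Reasoning
    regroup : ∀ c x a q r → c + x * ((x - a) * q + r) ≡ (x - a) * (r + x * q) + (c + a * r)
    regroup = solve-∀

  -- A root a of p with vanishing quotient forces p to vanish: each coefficient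
  -- of p is recovered from the quotient's coefficients and p(a).
  vanishing : ∀ {n} (p : Vec ℤ (suc n)) a →
    All (_≡ 0ℤ) (divideBy p a) → evalℤ p a ≡ 0ℤ → All (_≡ 0ℤ) p
  vanishing (c ∷ []) a [] pa≡0 = trans (sym (c+a*0≡c c a)) pa≡0 ∷ []
  vanishing (c ∷ c' ∷ p) a (qa≡0 ∷ rest) pa≡0 = c≡0 ∷ vanishing (c' ∷ p) a rest qa≡0
    where
    c≡0 : c ≡ 0ℤ
    c≡0 = trans (sym (c+a*0≡c c a)) (trans (cong (λ v → c + a * v) (sym qa≡0)) pa≡0)

  -- Every root x ≠ a of p is a root of the quotient by (x - a), as ℤ has no zero divisors.
  quotient-root : ∀ {n} (p : Vec ℤ (suc n)) {a x} →
    evalℤ p a ≡ 0ℤ → evalℤ p x ≡ 0ℤ → x ≢ a → evalℤ (divideBy p a) x ≡ 0ℤ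
  quotient-root p {a} {x} pa≡0 px≡0 x≢a =
    [ (λ x-a≡0 → contradiction (ℤP.i-j≡0⇒i≡j x a x-a≡0) x≢a) , id ]′
      (ℤP.i*j≡0⇒i≡0∨j≡0 (x - a) product≡0)
    where
    open ≡-Reasoning
    product≡0 : (x - a) * evalℤ (divideBy p a) x ≡ 0ℤ
    product≡0 = begin
      (x - a) * evalℤ (divideBy p a) x              ≡⟨ sym (ℤP.+-identityʳ _) ⟩
      (x - a) * evalℤ (divideBy p a) x + 0ℤ         ≡⟨ cong (λ v → (x - a) * evalℤ (divideBy p a) x + v) (sym pa≡0) ⟩
      (x - a) * evalℤ (divideBy p a) x + evalℤ p a  ≡⟨ sym (division p a x) ⟩
      evalℤ p x                                     ≡⟨ px≡0 ⟩
      0ℤ ∎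

  roots⇒zero : ∀ n (p : Vec ℤ n) (pts : Fin n → ℤ) → Injective _≡_ _≡_ pts →
    (∀ t → evalℤ p (pts t) ≡ 0ℤ) → All (_≡ 0ℤ) p
  roots⇒zero zero [] pts inj root = []
  roots⇒zero (suc n) p pts inj root =
    vanishing p (pts zero)
      (roots⇒zero n (divideBy p (pts zero)) (pts ∘ suc) (FP.suc-injective ∘ inj)
        (λ t → quotient-root p (root zero) (root (suc t)) (FP.0≢1+n ∘ sym ∘ inj)))
      (root zero)

  evalℕ : ∀ {n} → Vec ℕ n → ℕ → ℕ
  evalℕ [] x = 0
  evalℕ (c ∷ p) x = c ℕ.+ x ℕ.* evalℕ p x

  difference : ∀ {n} → Vec ℕ n → Vec ℕ n → Vec ℤ n
  difference = zipWith (λ a b → + a - + b)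

  evalℤ-difference : ∀ {n} (x y : Vec ℕ n) p →
    evalℤ (difference x y) (+ p) ≡ + evalℕ x p - + evalℕ y p
  evalℤ-difference [] [] p = refl
  evalℤ-difference (a ∷ x) (b ∷ y) p = begin
    (+ a - + b) + + p * evalℤ (difference x y) (+ p)
      ≡⟨ cong (λ v → (+ a - + b) + + p * v) (evalℤ-difference x y p) ⟩
    (+ a - + b) + + p * (+ evalℕ x p - + evalℕ y p)
      ≡⟨ regroup (+ a) (+ b) (+ p) (+ evalℕ x p) (+ evalℕ y p) ⟩
    (+ a + + p * + evalℕ x p) - (+ b + + p * + evalℕ y p)
      ≡⟨ sym (cong₂ _-_ (horner a (evalℕ x p)) (horner b (evalℕ y p))) ⟩
    + (a ℕ.+ p ℕ.* evalℕ x p) - + (b ℕ.+ p ℕ.* evalℕ y p) ∎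
    where
    open ≡-Reasoning
    regroup : ∀ a b p u v → (a - b) + p * (u - v) ≡ (a + p * u) - (b + p * v)
    regroup = solve-∀
    horner : ∀ c u → + (c ℕ.+ p ℕ.* u) ≡ + c + + p * + u
    horner c u = trans (ℤP.pos-+ c (p ℕ.* u)) (cong (λ v → + c + v) (ℤP.pos-* p u))

  difference-zero : ∀ {n} (x y : Vec ℕ n) → All (_≡ 0ℤ) (difference x y) → x ≡ y
  difference-zero [] [] [] = refl
  difference-zero (a ∷ x) (b ∷ y) (a-b≡0 ∷ rest) =
    cong₂ _∷_ (ℤP.+-injective (ℤP.i-j≡0⇒i≡j _ _ a-b≡0)) (difference-zero x y rest)

  agree⇒equal : ∀ {n} (x y : Vec ℕ n) (pts : Fin n → ℕ) → Injective _≡_ _≡_ pts →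
    (∀ t → evalℕ x (pts t) ≡ evalℕ y (pts t)) → x ≡ y
  agree⇒equal {n} x y pts inj agree =
    difference-zero x y (roots⇒zero n (difference x y) (+_ ∘ pts) (inj ∘ ℤP.+-injective)
      (λ t → trans (evalℤ-difference x y (pts t)) (ℤP.i≡j⇒i-j≡0 (cong +_ (agree t)))))


module Combinatorics where

  open import Data.Nat as ℕ using (ℕ; zero; suc; z≤n; s≤s; _^_; _≤_; _<_)
  import Data.Nat.Properties as ℕP
  open import Data.Bool using (true)
  open import Data.Fin as F using (Fin; zero; suc; finToFun; funToFin)
  import Data.Fin.Properties as FP
  open import Data.Fin.Subset using (Subset; ∣_∣; _∈_; _∩_; _-_; inside; outside)
  open import Data.Fin.Subset.Properties
    using (x∈p∧x≢y⇒x∈p-y; x∈p⇒∣p-x∣<∣p∣; x∈p∩q⁺; x∈p∩q⁻; anySubset?)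
  open import Data.Vec using (Vec; []; _∷_; here; there; lookup; tabulate)
  open import Data.Vec.Properties using (lookup∘tabulate; tabulate∘lookup; []=⇒lookup; lookup⇒[]=)
  open import Data.Product using (Σ; ∃; _×_; _,_; proj₁; proj₂)
  open import Data.Empty using (⊥; ⊥-elim)
  open import Function using (_∘_)
  open import Function.Definitions using (Injective)
  open import Relation.Binary using (tri<; tri≈; tri>)
  open import Relation.Binary.PropositionalEquality
  open import Relation.Nullary using (Dec; yes; no; _×-dec_; _→-dec_)
  open import Relation.Nullary.Decidable using (map′)
  open import Relation.Unary using (Decidable)

  funToFin-injective : ∀ {a b} {f g : Fin a → Fin b} → funToFin f ≡ funToFin g → ∀ i → f i ≡ g i
  funToFin-injective {f = f} {g} same i = trans (sym (FP.finToFun-funToFin f i))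
    (trans (cong (λ x → finToFun x i) same) (FP.finToFun-funToFin g i))

  increasing⇒injective : ∀ {a b} {f : Fin a → Fin b} →
    StrictlyIncreasing f → Injective _≡_ _≡_ f
  increasing⇒injective {f = f} inc {i} {j} fi≡fj with FP.<-cmp i j
  ... | tri< i<j _ _ = ⊥-elim (FP.<-irrefl fi≡fj (inc i j i<j))
  ... | tri≈ _ i≡j _ = i≡j
  ... | tri> _ _ j<i = ⊥-elim (FP.<-irrefl (sym fi≡fj) (inc j i j<i))

  -- A set into which Fin r injects has at least r members: remove the image
  -- of zero, which costs one member, and recurse on the remaining points.
  injective⇒≤∣∣ : ∀ {r m} {s : Subset m} (f : Fin r → Fin m) →
    Injective _≡_ _≡_ f → (∀ i → f i ∈ s) → r ≤ ∣ s ∣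
  injective⇒≤∣∣ {zero} f inj mem = z≤n
  injective⇒≤∣∣ {suc r} f inj mem =
    ℕP.≤-trans (s≤s (injective⇒≤∣∣ (f ∘ suc) (FP.suc-injective ∘ inj) rest))
               (x∈p⇒∣p-x∣<∣p∣ (mem zero))
    where
    rest : ∀ i → f (suc i) ∈ _ - f zero
    rest i = x∈p∧x≢y⇒x∈p-y (mem (suc i)) (FP.0≢1+n ∘ sym ∘ inj)

  select : ∀ {m} r (s : Subset m) → r ≤ ∣ s ∣ →
    Σ (Fin r → Fin m) λ f → StrictlyIncreasing f × (∀ i → f i ∈ s)
  select zero s _ = (λ ()) , (λ ()) , (λ ())
  select (suc r) (inside ∷ s) (s≤s r≤∣s∣) with select r s r≤∣s∣
  ... | f , inc , mem = g , g-inc , g-mem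
    where
    g : Fin (suc r) → Fin _
    g zero = zero
    g (suc i) = suc (f i)
    g-inc : StrictlyIncreasing g
    g-inc zero (suc j) _ = s≤s z≤n
    g-inc (suc i) (suc j) (s≤s i<j) = s≤s (inc i j i<j)
    g-mem : ∀ i → g i ∈ inside ∷ s
    g-mem zero = here
    g-mem (suc i) = there (mem i)
  select (suc r) (outside ∷ s) enough with select (suc r) s enough
  ... | f , inc , mem = suc ∘ f , (λ i j i<j → s≤s (inc i j i<j)) , there ∘ mem

  column : ∀ {m n} → Matrix m n → Fin n → Subset m
  column A j = tabulate (λ i → A i j)

  column⁺ : ∀ {m n} (A : Matrix m n) {i j} → A i j ≡ true → i ∈ column A j
  column⁺ A {i} Aij = lookup⇒[]= i _ (trans (lookup∘tabulate _ i) Aij)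

  column⁻ : ∀ {m n} (A : Matrix m n) {i j} → i ∈ column A j → A i j ≡ true
  column⁻ A {i} i∈col = trans (sym (lookup∘tabulate _ i)) ([]=⇒lookup i∈col)

  pair : ∀ {n} → Fin n → Fin n → Fin 2 → Fin n
  pair j j' zero = j
  pair j j' (suc _) = j'

  pair-increasing : ∀ {n} {j j' : Fin n} → j F.< j' → StrictlyIncreasing (pair j j')
  pair-increasing j<j' zero (suc zero) _ = j<j'
  pair-increasing j<j' (suc zero) (suc zero) (s≤s ())

  SmallOverlaps : ∀ {m n} → ℕ → (Fin n → Subset m) → Set
  SmallOverlaps r cs = ∀ j j' → j F.< j' → ∣ cs j ∩ cs j' ∣ < r

  overlap⇒contains : ∀ {m n r} (A : Matrix m n) {j j'} → j F.< j' →
    r ≤ ∣ column A j ∩ column A j' ∣ → Contains A (P r 2)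
  overlap⇒contains {r = r} A {j} {j'} j<j' big with select r _ big
  ... | f , inc , mem = f , pair j j' , inc , pair-increasing j<j' , ones
    where
    ones : ∀ i c → P r 2 i c ≡ true → A (f i) (pair j j' c) ≡ true
    ones i zero _ = column⁻ A (proj₁ (x∈p∩q⁻ _ _ (mem i)))
    ones i (suc zero) _ = column⁻ A (proj₂ (x∈p∩q⁻ _ _ (mem i)))

  avoids⇒smallOverlaps : ∀ {m n r} (A : Matrix m n) →
    Avoids A (P r 2) → SmallOverlaps r (column A)
  avoids⇒smallOverlaps A avoids j j' j<j' =
    ℕP.≰⇒> (avoids ∘ overlap⇒contains A j<j')

  -- A copy of P_{r,2} puts its r rows into the overlap of its two columns.
  smallOverlaps⇒avoids : ∀ {m n r} (A : Matrix m n) →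
    SmallOverlaps r (column A) → Avoids A (P r 2)
  smallOverlaps⇒avoids A small (f , g , f-inc , g-inc , ones) =
    ℕP.<⇒≱ (small (g zero) (g (suc zero)) (g-inc zero (suc zero) (s≤s z≤n)))
      (injective⇒≤∣∣ f (increasing⇒injective f-inc) (λ i →
        x∈p∩q⁺ (column⁺ A (ones i zero refl) , column⁺ A (ones i (suc zero) refl))))

  -- Distinct columns of an admissible matrix (k ≥ r) carry distinct increasing
  -- r-tuples of rows of ones; there are only m ^ r such tuples.
  columns≤m^r : ∀ {m n r k} → r ≤ k → (A : Matrix m n) →
    Admissible k (P r 2) A → n ≤ m ^ r
  columns≤m^r {m} {n} {r} r≤k A (avoids , heavy) =
    ℕP.≮⇒≥ (λ m^r<n → collision (FP.pigeonhole m^r<n (funToFin ∘ tuple)))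
    where
    chosen : ∀ j → Σ (Fin r → Fin m) λ f → StrictlyIncreasing f × (∀ t → f t ∈ column A j)
    chosen j = select r (column A j) (ℕP.≤-trans r≤k (heavy j))
    tuple : Fin n → Fin r → Fin m
    tuple j = proj₁ (chosen j)
    collision : (∃ λ i → ∃ λ j → i F.< j × funToFin (tuple i) ≡ funToFin (tuple j)) → ⊥
    collision (i , j , i<j , same) =
      avoids (tuple i , pair i j , proj₁ (proj₂ (chosen i)) , pair-increasing i<j , ones)
      where
      ones : ∀ t c → P r 2 t c ≡ true → A (tuple i t) (pair i j c) ≡ true
      ones t zero _ = column⁻ A (proj₂ (proj₂ (chosen i)) t)
      ones t (suc zero) _ = subst (λ x → A x j ≡ true) (sym (funToFin-injective same t))
                              (column⁻ A (proj₂ (proj₂ (chosen j)) t))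

  anyVec? : ∀ {S : Set} → (∀ {Q : S → Set} → Decidable Q → Dec (∃ Q)) →
    ∀ n {Q : Vec S n → Set} → Decidable Q → Dec (∃ Q)
  anyVec? anyS zero Q? = map′ ([] ,_) (λ { ([] , q) → q }) (Q? [])
  anyVec? anyS (suc n) Q? =
    map′ (λ { (s , v , q) → s ∷ v , q }) (λ { (s ∷ v , q) → s , v , q })
         (anyS (λ s → anyVec? anyS n (λ v → Q? (s ∷ v))))

  Qualifies : ∀ {m n} → ℕ → ℕ → (Fin n → Subset m) → Set
  Qualifies r k cs = SmallOverlaps r cs × (∀ j → k ≤ ∣ cs j ∣)

  qualifies? : ∀ {m n} r k (cs : Fin n → Subset m) → Dec (Qualifies r k cs)
  qualifies? r k cs =
    FP.all? (λ j → FP.all? (λ j' → (j F.<? j') →-dec (∣ cs j ∩ cs j' ∣ ℕ.<? r)))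
    ×-dec FP.all? (λ j → k ℕ.≤? ∣ cs j ∣)

  qualifies-cong : ∀ {m n r k} {cs ds : Fin n → Subset m} → (∀ j → cs j ≡ ds j) →
    Qualifies r k cs → Qualifies r k ds
  qualifies-cong {r = r} {k} cs≗ds (small , heavy) =
    (λ j j' j<j' → subst (λ x → ∣ x ∣ < r) (cong₂ _∩_ (cs≗ds j) (cs≗ds j')) (small j j' j<j')) ,
    (λ j → subst (λ x → k ≤ ∣ x ∣) (cs≗ds j) (heavy j))

  -- "There is an admissible m × n matrix" is decidable: search all column vectors.
  Realisable : ℕ → ℕ → ℕ → ℕ → Set
  Realisable r k m n = Σ (Matrix m n) (Admissible k (P r 2))

  realisable? : ∀ r k m n → Dec (Realisable r k m n)
  realisable? r k m n =
    map′ (λ { (cs , q) → fromColumns cs , toAdmissible (fromColumns cs)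
                           (qualifies-cong (λ j → sym (tabulate∘lookup (lookup cs j))) q) })
         (λ { (A , adm) → tabulate (column A) ,
                           qualifies-cong (λ j → sym (lookup∘tabulate (column A) j)) (fromAdmissible A adm) })
         (anyVec? anySubset? n (λ cs → qualifies? r k (lookup cs)))
    where
    fromColumns : Vec (Subset m) n → Matrix m n
    fromColumns cs i j = lookup (lookup cs j) i
    toAdmissible : (A : Matrix m n) → Qualifies r k (column A) → Admissible k (P r 2) A
    toAdmissible A (small , heavy) = smallOverlaps⇒avoids A small , heavy
    fromAdmissible : (A : Matrix m n) → Admissible k (P r 2) A → Qualifies r k (column A)
    fromAdmissible A (avoids , heavy) = avoids⇒smallOverlaps A avoids , heavy

  greatest : (R : ℕ → Set) → Decidable R → R 0 → (N : ℕ) → (∀ n → R n → n ≤ N) →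
    Σ ℕ λ e → R e × (∀ n → R n → n ≤ e)
  greatest R R? R0 zero bound = 0 , R0 , bound
  greatest R R? R0 (suc N) bound with R? (suc N)
  ... | yes RN = suc N , RN , bound
  ... | no ¬RN = greatest R R? R0 N (λ n Rn →
    ℕP.≤-pred (ℕP.≤∧≢⇒< (bound n Rn) (λ { refl → ¬RN Rn })))

  ex-exists : ∀ {r k} → r ≤ k → ∀ m → Σ ℕ λ e → IsEx k m (P r 2) e × e ≤ m ^ r
  ex-exists {r} {k} r≤k m with greatest (Realisable r k m) (realisable? r k m) empty (m ^ r)
                                 (λ n (A , adm) → columns≤m^r r≤k A adm)
    where
    empty : Realisable r k m 0
    empty = (λ _ ()) , (λ (_ , g , _) → noColumn (g zero)) , λ ()
      where
      noColumn : Fin 0 → ⊥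
      noColumn ()
  ... | e , (A , adm) , maximal = e , ((A , adm) , λ n A adm → maximal n (A , adm)) , columns≤m^r r≤k A adm


module Construction where

  open Polynomials
  open Combinatorics

  open import Data.Nat as ℕ using (ℕ; zero; suc; z≤n; s≤s; _+_; _*_; _^_; _≤_; _<_; _≥_; NonZero)
  import Data.Nat.Properties as ℕP
  open import Data.Nat.DivMod
    using (_/_; _%_; m≡m%n+[m/n]*n; m%n<n; m/n*n≤m; m≥n⇒m/n>0; [m+kn]%n≡m%n; m<n⇒m%n≡m;
           +-distrib-/-∣ʳ; m<n⇒m/n≡0; m*n/n≡m)
  open import Data.Nat.Divisibility using (n∣m*n)
  open import Data.Nat.Tactic.RingSolver using (solve-∀)
  open import Data.Bool using (true)
  open import Data.Fin as F using (Fin; zero; suc; toℕ; fromℕ<; finToFun; funToFin)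
  import Data.Fin.Properties as FP
  open import Data.Vec using (Vec; []; _∷_; lookup; tabulate)
  open import Data.Vec.Properties using (lookup∘tabulate)
  open import Data.Vec.Relation.Unary.All using (All; []; _∷_)
  open import Data.Vec.Relation.Unary.All.Properties using (tabulate⁺)
  open import Data.Product using (Σ; _×_; _,_)
  open import Function using (_∘_)
  open import Function.Definitions using (Injective)
  open import Relation.Binary.PropositionalEquality
  open import Relation.Nullary using (Dec; yes; does)
  open import Relation.Nullary.Decidable using (dec-true)

  finToFun-injective : ∀ a b {i j : Fin (b ^ a)} →
    (∀ t → finToFun {b} {a} i t ≡ finToFun j t) → i ≡ j
  finToFun-injective a b {i} {j} same =
    trans (sym (FP.funToFin-finToFin {a} {b} i)) (trans (cong-funToFin same) (FP.funToFin-finToFin {a} {b} j))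
    where
    cong-funToFin : ∀ {a} {f g : Fin a → Fin b} → (∀ t → f t ≡ g t) → funToFin f ≡ funToFin g
    cong-funToFin {zero} _ = refl
    cong-funToFin {suc a} f≗g = cong₂ F.combine (f≗g zero) (cong-funToFin (f≗g ∘ suc))

  -- The base-q digits of j < q ^ r, read as the coefficients of a polynomial.
  digits : ∀ {q} r → Fin (q ^ r) → Vec ℕ r
  digits r j = tabulate (toℕ ∘ finToFun j)

  digits<q : ∀ {q} r (j : Fin (q ^ r)) → All (_< q) (digits r j)
  digits<q r j = tabulate⁺ (FP.toℕ<n ∘ finToFun j)

  digits-injective : ∀ {q} r {j j' : Fin (q ^ r)} → digits r j ≡ digits r j' → j ≡ j'
  digits-injective {q} r {j} {j'} same = finToFun-injective r q λ t → FP.toℕ-injective (begin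
    toℕ (finToFun j t)        ≡⟨ sym (lookup∘tabulate (toℕ ∘ finToFun j) t) ⟩
    lookup (digits r j) t     ≡⟨ cong (λ v → lookup v t) same ⟩
    lookup (digits r j') t    ≡⟨ lookup∘tabulate (toℕ ∘ finToFun j') t ⟩
    toℕ (finToFun j' t)       ∎)
    where open ≡-Reasoning

  weight : ℕ → ℕ → ℕ
  weight k zero = 1
  weight k (suc r) = 1 + k * weight k r

  weight-nonZero : ∀ k r → NonZero (weight k r)
  weight-nonZero k zero = _
  weight-nonZero k (suc r) = _

  evalℕ-bound : ∀ {r} q k (x : Vec ℕ r) p → All (_< q) x → p ≤ k → 0 < q →
    evalℕ x p < q * weight k r
  evalℕ-bound q k [] p [] p≤k q>0 = subst (0 <_) (sym (ℕP.*-identityʳ q)) q>0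
  evalℕ-bound {suc r} q k (c ∷ x) p (c<q ∷ x<q) p≤k q>0 =
    subst (c + p * evalℕ x p <_) (factor q k (weight k r))
      (ℕP.+-mono-<-≤ c<q (ℕP.*-mono-≤ p≤k (ℕP.<⇒≤ (evalℕ-bound q k x p x<q p≤k q>0))))
    where
    factor : ∀ q k w → q + k * (q * w) ≡ q * (1 + k * w)
    factor = solve-∀

  -- Writing a row as p + b * k with p < k, p is its position and b its block.
  position : ∀ p b k .{{_ : NonZero k}} → p < k → (p + b * k) % k ≡ p
  position p b k p<k = trans ([m+kn]%n≡m%n p b k) (m<n⇒m%n≡m p<k)

  block : ∀ p b k .{{_ : NonZero k}} → p < k → (p + b * k) / k ≡ b
  block p b k p<k = trans (+-distrib-/-∣ʳ p (n∣m*n b)) (cong₂ _+_ (m<n⇒m/n≡0 p<k) (m*n/n≡m b k))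

  does-true : ∀ {A : Set} (a? : Dec A) → does a? ≡ true → A
  does-true (yes a) _ = a

  -- The construction: m rows split into blocks of k consecutive rows, and
  -- q ^ r columns indexed by the polynomials with r coefficients below q. A
  -- column has a one at position p of block b iff its polynomial maps p to b.
  -- Two distinct polynomials agree on fewer than r points, so two columns share
  -- fewer than r ones, while each column has one one in each of k positions.
  module PolynomialCode (r k q m : ℕ) .{{_ : NonZero k}} (q>0 : 0 < q)
                        (fits : k * (q * weight k r) ≤ m) where

    poly : Fin (q ^ r) → Vec ℕ r
    poly = digits r

    codeMatrix : Matrix m (q ^ r)
    codeMatrix ρ j = does (toℕ ρ / k ℕ.≟ evalℕ (poly j) (toℕ ρ % k))

    row : Fin (q ^ r) → ℕ → ℕ
    row j p = p + evalℕ (poly j) p * k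

    row<m : ∀ j p → p < k → row j p < m
    row<m j p p<k = ℕP.<-≤-trans (ℕP.+-monoˡ-< (evalℕ (poly j) p * k) p<k) (begin
      k + evalℕ (poly j) p * k  ≤⟨ ℕP.*-monoˡ-≤ k (evalℕ-bound q k (poly j) p (digits<q r j) (ℕP.<⇒≤ p<k) q>0) ⟩
      q * weight k r * k        ≡⟨ ℕP.*-comm (q * weight k r) k ⟩
      k * (q * weight k r)      ≤⟨ fits ⟩
      m                         ∎)
      where open ℕP.≤-Reasoning

    oneAt : Fin (q ^ r) → Fin k → Fin m
    oneAt j p = fromℕ< (row<m j (toℕ p) (FP.toℕ<n p))

    oneAt-row : ∀ j p → toℕ (oneAt j p) ≡ row j (toℕ p)
    oneAt-row j p = FP.toℕ-fromℕ< _

    oneAt-injective : ∀ j → Injective _≡_ _≡_ (oneAt j)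
    oneAt-injective j {p} {p'} same = FP.toℕ-injective (begin
      toℕ p                          ≡⟨ sym (position (toℕ p) (evalℕ (poly j) (toℕ p)) k (FP.toℕ<n p)) ⟩
      row j (toℕ p) % k              ≡⟨ cong (_% k) (trans (sym (oneAt-row j p)) (trans (cong toℕ same) (oneAt-row j p'))) ⟩
      row j (toℕ p') % k             ≡⟨ position (toℕ p') (evalℕ (poly j) (toℕ p')) k (FP.toℕ<n p') ⟩
      toℕ p'                         ∎)
      where open ≡-Reasoning

    oneAt-one : ∀ j p → codeMatrix (oneAt j p) j ≡ true
    oneAt-one j p = dec-true (_ ℕ.≟ _) (begin
      toℕ (oneAt j p) / k                          ≡⟨ cong (_/ k) (oneAt-row j p) ⟩
      row j (toℕ p) / k                            ≡⟨ block (toℕ p) (evalℕ (poly j) (toℕ p)) k (FP.toℕ<n p) ⟩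
      evalℕ (poly j) (toℕ p)                       ≡⟨ cong (evalℕ (poly j)) (sym (position (toℕ p) (evalℕ (poly j) (toℕ p)) k (FP.toℕ<n p))) ⟩
      evalℕ (poly j) (row j (toℕ p) % k)           ≡⟨ cong (λ x → evalℕ (poly j) (x % k)) (sym (oneAt-row j p)) ⟩
      evalℕ (poly j) (toℕ (oneAt j p) % k)         ∎)
      where open ≡-Reasoning

    one⇒block : ∀ {ρ j} → codeMatrix ρ j ≡ true → toℕ ρ / k ≡ evalℕ (poly j) (toℕ ρ % k)
    one⇒block one = does-true (_ ℕ.≟ _) one

    heavy : ∀ j → onesInColumn codeMatrix j ≥ k
    heavy j = injective⇒≤∣∣ (oneAt j) (oneAt-injective j) (column⁺ codeMatrix ∘ oneAt-one j)

    -- The rows of a copy of P_{r,2} have distinct positions at which the two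
    -- column polynomials agree; hence the polynomials, and the columns, coincide.
    avoids : Avoids codeMatrix (P r 2)
    avoids (f , g , f-inc , g-inc , ones) =
      FP.<-irrefl (digits-injective r (agree⇒equal (poly (g zero)) (poly (g (suc zero))) pts pts-injective agree))
                  (g-inc zero (suc zero) (s≤s z≤n))
      where
      pts : Fin r → ℕ
      pts t = toℕ (f t) % k
      blockOf : ∀ c t → toℕ (f t) / k ≡ evalℕ (poly (g c)) (pts t)
      blockOf c t = one⇒block (ones t c refl)
      agree : ∀ t → evalℕ (poly (g zero)) (pts t) ≡ evalℕ (poly (g (suc zero))) (pts t)
      agree t = trans (sym (blockOf zero t)) (blockOf (suc zero) t)
      pts-injective : Injective _≡_ _≡_ pts
      pts-injective {t} {t'} same = increasing⇒injective f-inc (FP.toℕ-injective (begin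
        toℕ (f t)                                 ≡⟨ m≡m%n+[m/n]*n (toℕ (f t)) k ⟩
        pts t + (toℕ (f t) / k) * k               ≡⟨ cong (λ b → pts t + b * k) (blockOf zero t) ⟩
        pts t + evalℕ (poly (g zero)) (pts t) * k ≡⟨ cong (λ p → p + evalℕ (poly (g zero)) p * k) same ⟩
        pts t' + evalℕ (poly (g zero)) (pts t') * k ≡⟨ cong (λ b → pts t' + b * k) (sym (blockOf zero t')) ⟩
        pts t' + (toℕ (f t') / k) * k             ≡⟨ sym (m≡m%n+[m/n]*n (toℕ (f t')) k) ⟩
        toℕ (f t')                                ∎))
        where open ≡-Reasoning

    admissible : Admissible k (P r 2) codeMatrix
    admissible = avoids , heavy

  -- The construction applies (with q = 1) as soon as m reaches the threshold.
  threshold : ℕ → ℕ → ℕ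
  threshold r k = k * weight k r

  m≤2d[m/d] : ∀ m d .{{_ : NonZero d}} → d ≤ m → m ≤ 2 * d * (m / d)
  m≤2d[m/d] m d d≤m = begin
    m                          ≡⟨ m≡m%n+[m/n]*n m d ⟩
    m % d + m / d * d          ≤⟨ ℕP.+-monoˡ-≤ (m / d * d) (ℕP.<⇒≤ (m%n<n m d)) ⟩
    d + m / d * d              ≤⟨ ℕP.+-monoˡ-≤ (m / d * d) (ℕP.m≤n*m d (m / d) {{ℕ.>-nonZero (m≥n⇒m/n>0 d≤m)}}) ⟩
    m / d * d + m / d * d      ≡⟨ double (m / d) d ⟩
    2 * d * (m / d)            ∎
    where
    open ℕP.≤-Reasoning
    double : ∀ q d → q * d + q * d ≡ 2 * d * q
    double = solve-∀

  *-^-distrib : ∀ a b n → (a * b) ^ n ≡ a ^ n * b ^ n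
  *-^-distrib a b zero = refl
  *-^-distrib a b (suc n) = trans (cong (a * b *_) (*-^-distrib a b n)) (interchange a b (a ^ n) (b ^ n))
    where
    interchange : ∀ a b x y → a * b * (x * y) ≡ a * x * (b * y)
    interchange = solve-∀

  scale : ℕ → ℕ → ℕ
  scale r k = (2 * threshold r k) ^ r

  ex-sandwich : ∀ {r k} → r ≤ k → .{{k≢0 : NonZero k}} → ∀ m → threshold r k ≤ m →
    Σ ℕ λ e → IsEx k m (P r 2) e × m ^ r ≤ scale r k * e × e ≤ m ^ r
  ex-sandwich {r} {k} r≤k {{k≢0}} m d≤m with ex-exists r≤k m
  ... | e , ex@(_ , maximal) , e≤m^r = e , ex , m^r≤ , e≤m^r
    where
    d : ℕ
    d = threshold r k
    instance
      d-nonZero : NonZero d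
      d-nonZero = ℕP.m*n≢0 k (weight k r) {{k≢0}} {{weight-nonZero k r}}
    q : ℕ
    q = m / d
    q>0 : 0 < q
    q>0 = m≥n⇒m/n>0 d≤m
    fits : k * (q * weight k r) ≤ m
    fits = subst (_≤ m) (rearrange q k (weight k r)) (m/n*n≤m m d)
      where
      rearrange : ∀ q k w → q * (k * w) ≡ k * (q * w)
      rearrange = solve-∀
    open PolynomialCode r k q m q>0 fits using (codeMatrix; admissible)
    -- the code has q ^ r columns, so q ^ r ≤ e by maximality of e
    m^r≤ : m ^ r ≤ scale r k * e
    m^r≤ = begin
      m ^ r                ≤⟨ ℕP.^-monoˡ-≤ r (m≤2d[m/d] m d d≤m) ⟩
      (2 * d * q) ^ r      ≡⟨ *-^-distrib (2 * d) q r ⟩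
      (2 * d) ^ r * q ^ r  ≤⟨ ℕP.*-monoʳ-≤ ((2 * d) ^ r) (maximal (q ^ r) codeMatrix admissible) ⟩
      (2 * d) ^ r * e      ∎
      where open ℕP.≤-Reasoning


module RationalBounds where

  open import Data.Nat as ℕ using (ℕ; suc; z≤n; s≤s)
  import Data.Nat.Properties as ℕP
  open import Data.Nat.Coprimality as Coprime using (1-coprimeTo)
  open import Data.Integer as ℤ using (+_; +≤+; +<+)
  import Data.Integer.Properties as ℤP
  open import Data.Rational using (ℚ; mkℚ; 0ℚ; 1ℚ; _<_; _≤_; _*_; _/_; *≤*; *<*)
  open import Data.Rational.Properties using (normalize-coprime; toℚᵘ-cancel-≤; toℚᵘ-homo-*; *-identityˡ)
  import Data.Rational.Unnormalised as ℚᵘ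
  import Data.Rational.Unnormalised.Properties as ℚᵘP
  open import Relation.Binary.PropositionalEquality

  -- The theorem writes a natural number n as the rational (+ n) / 1, which is
  -- the normalised fraction with numerator n and denominator 1.
  n/1≡mkℚ : ∀ n → (+ n) / 1 ≡ mkℚ (+ n) 0 (Coprime.sym (1-coprimeTo n))
  n/1≡mkℚ n = normalize-coprime (Coprime.sym (1-coprimeTo n))

  -- The rational 1 / (1 + D).
  reciprocal : ℕ → ℚ
  reciprocal D = mkℚ (+ 1) D (1-coprimeTo (suc D))

  reciprocal-positive : ∀ D → 0ℚ < reciprocal D
  reciprocal-positive D = *<* (+<+ (s≤s z≤n))

  reciprocal≤1 : ∀ D → reciprocal D ≤ 1ℚ
  reciprocal≤1 D = *≤* (+≤+ (s≤s z≤n))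

  ≤⇒≤1* : ∀ e M → e ℕ.≤ M → (+ e) / 1 ≤ 1ℚ * ((+ M) / 1)
  ≤⇒≤1* e M e≤M rewrite *-identityˡ ((+ M) / 1) | n/1≡mkℚ e | n/1≡mkℚ M =
    *≤* (subst₂ ℤ._≤_ (sym (ℤP.*-identityʳ (+ e))) (sym (ℤP.*-identityʳ (+ M))) (+≤+ e≤M))

  ≤*⇒reciprocal*≤ : ∀ M D e → M ℕ.≤ D ℕ.* e → reciprocal D * ((+ M) / 1) ≤ (+ e) / 1
  ≤*⇒reciprocal*≤ M D e M≤De rewrite n/1≡mkℚ M | n/1≡mkℚ e =
    toℚᵘ-cancel-≤ (ℚᵘP.≤-respˡ-≃ (ℚᵘP.≃-sym (toℚᵘ-homo-* (reciprocal D) (mkℚ (+ M) 0 (Coprime.sym (1-coprimeTo M)))))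
      (ℚᵘ.*≤* (subst₂ ℤ._≤_ lhs rhs (+≤+ M≤e*[1+D]))))
    where
    M≤e*[1+D] : M ℕ.≤ e ℕ.* suc D
    M≤e*[1+D] = ℕP.≤-trans M≤De (subst (D ℕ.* e ℕ.≤_) (ℕP.*-comm (suc D) e) (ℕP.m≤n+m (D ℕ.* e) e))
    lhs : + M ≡ (+ 1 ℤ.* + M) ℤ.* + 1
    lhs = sym (trans (ℤP.*-identityʳ _) (ℤP.*-identityˡ _))
    rhs : + (e ℕ.* suc D) ≡ + e ℤ.* + (suc D ℕ.* 1)
    rhs = trans (ℤP.pos-* e (suc D)) (cong (λ z → + e ℤ.* + z) (sym (ℕP.*-identityʳ (suc D))))


open import Data.Nat as ℕ using (ℕ; _^_; _≥_; NonZero)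
import Data.Nat.Properties as ℕP
open import Data.Integer using (+_)
open import Data.Rational using (ℚ; 0ℚ; 1ℚ; _<_; _≤_; _*_; _/_)
open import Data.Product using (Σ; _×_; _,_)
open Construction using (threshold; scale; ex-sandwich)
open RationalBounds using (reciprocal; reciprocal-positive; reciprocal≤1; ≤⇒≤1*; ≤*⇒reciprocal*≤)

mainTheorem5 : (r : ℕ) → r ≥ 1 → (k : ℕ) → k ≥ r →
    Σ ℚ λ a → Σ ℚ λ b → 0ℚ < a × a ≤ b ×
    Σ ℕ λ m₀ → ∀ (m : ℕ) → m ≥ m₀ →
    Σ ℕ λ e → IsEx k m (P r 2) e ×
    (a * ((+ (m ^ r)) / 1) ≤ (+ e) / 1) × ((+ e) / 1 ≤ b * ((+ (m ^ r)) / 1))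
mainTheorem5 r r≥1 k k≥r =
  reciprocal (scale r k) , 1ℚ , reciprocal-positive (scale r k) , reciprocal≤1 (scale r k) ,
  threshold r k , bounds
  where
  instance
    k≢0 : NonZero k
    k≢0 = ℕ.>-nonZero (ℕP.≤-trans r≥1 k≥r)
  bounds : ∀ m → m ≥ threshold r k → Σ ℕ λ e → IsEx k m (P r 2) e ×
    (reciprocal (scale r k) * ((+ (m ^ r)) / 1) ≤ (+ e) / 1) × ((+ e) / 1 ≤ 1ℚ * ((+ (m ^ r)) / 1))
  bounds m m≥threshold with ex-sandwich k≥r m m≥threshold
  ... | e , ex , lower , upper =
    e , ex , ≤*⇒reciprocal*≤ (m ^ r) (scale r k) e lower , ≤⇒≤1* e (m ^ r) upper
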